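{- Let $p$ be a prime, let $i$ be an integer with $1\leq i\leq p-1$ and $k\in \mathbb{Z}_{>0}$. Then for any integer $l\geq k$, we have \[v_p\left(\frac{k!}{l!}S_{\leq i}(l,k)\right)\geq 0.\]
   Context: $v_p$ is the $p$-adic valuation. For integers $n\geq k\geq 0$ the incomplete exponential Bell polynomial is \[B_{n,k}(x_1,\dots,x_{n-k+1})=\sum_{\substack{(j_1,\dots,j_{n-k+1})\in\mathbb{N}^{n-k+1}\\ \sum_t j_t=k,\ \sum_t t j_t=n}}\frac{n!}{j_1!\cdots j_{n-k+1}!}\prod_{t=1}^{n-k+1}\left(\frac{x_t}{t!}\right)^{j_t}.\] The Stirling number of the second kind is $S(n,k)=B_{n,k}(1,1,\dots,1)$. For a positive integer $r$, the $r$-restricted Stirling number of the second kind is $S_{\leq r}(n,k)=S(n,k)$ if $n-k+1\leq r$, and $S_{\leq r}(n,k)=B_{n,k}(1,\dots,1,0,\dots,0)$ (first $r$ arguments equal to $1$, the rest $0$) otherwise. -}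

module Defs where

open import Data.Nat as ℕ using (ℕ; zero; suc; _≤ᵇ_; _≡ᵇ_; NonZero)
open import Data.Nat.Properties using (_!≢0; m*n≢0)
open import Data.Nat.Divisibility using (_∣_)
open import Data.Bool using (if_then_else_; _∧_)
open import Data.List using (List; []; _∷_; [_]; map; concatMap; upTo)
open import Data.Integer using (+_)
open import Data.Rational as ℚ using (ℚ; _/_; 0ℚ; 1ℚ)
open import Relation.Nullary using (¬_)

_^ℚ_ : ℚ → ℕ → ℚ
q ^ℚ zero = 1ℚ
q ^ℚ suc n = q ℚ.* (q ^ℚ n)

tuples : ℕ → ℕ → List (List ℕ)
tuples zero    b = [ [] ]
tuples (suc m) b = concatMap (λ j → map (j ∷_) (tuples m b)) (upTo (suc b))

-- For a tuple js = (j_t, j_{t+1}, …) whose first entry has index t: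
-- Σ j
sumJ : List ℕ → ℕ
sumJ []       = 0
sumJ (j ∷ js) = j ℕ.+ sumJ js

sumTJ : ℕ → List ℕ → ℕ
sumTJ t []       = 0
sumTJ t (j ∷ js) = t ℕ.* j ℕ.+ sumTJ (suc t) js

denom : ℕ → List ℕ → ℕ
denom t []       = 1
denom t (j ∷ js) = (j ℕ.! ℕ.* ((t ℕ.!) ℕ.^ j)) ℕ.* denom (suc t) js

denom≢0 : ∀ t js → NonZero (denom t js)
denom≢0 t []       = _
denom≢0 t (j ∷ js) = m*n≢0 _ _ {{m*n≢0 _ _ {{j !≢0}} {{pw (t ℕ.!) j {{t !≢0}}}}}} {{denom≢0 (suc t) js}}
  where
  pw : ∀ a n → {{NonZero a}} → NonZero (a ℕ.^ n)
  pw a zero    = _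
  pw a (suc n) {{nz}} = m*n≢0 a (a ℕ.^ n) {{nz}} {{pw a n {{nz}}}}

xprod : (ℕ → ℚ) → ℕ → List ℕ → ℚ
xprod x t []       = 1ℚ
xprod x t (j ∷ js) = (x t ^ℚ j) ℚ.* xprod x (suc t) js

bellTerm : ℕ → (ℕ → ℚ) → List ℕ → ℚ
bellTerm n x js = ((+ (n ℕ.!)) / denom 1 js) {{denom≢0 1 js}} ℚ.* xprod x 1 js

sumℚ : List ℚ → ℚ
sumℚ []       = 0ℚ
sumℚ (q ∷ qs) = q ℚ.+ sumℚ qs

-- incomplete exponential Bell polynomial B_{n,k}(x_1,…,x_{n-k+1}),
-- sum over (j_1,…,j_{n-k+1}) ∈ ℕ^{n-k+1} with Σ j_t = k, Σ t j_t = n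
-- (entries are automatically ≤ k, so enumerating {0,…,k}^{n-k+1} is complete)
bell : ℕ → ℕ → (ℕ → ℚ) → ℚ
bell n k x = sumℚ (map (λ js → if (sumJ js ≡ᵇ k) ∧ (sumTJ 1 js ≡ᵇ n)
                                 then bellTerm n x js else 0ℚ)
                       (tuples (suc (n ℕ.∸ k)) k))

stirling2 : ℕ → ℕ → ℚ
stirling2 n k = bell n k (λ _ → 1ℚ)

stirling2≤ : ℕ → ℕ → ℕ → ℚ
stirling2≤ r n k =
  if suc (n ℕ.∸ k) ≤ᵇ r then stirling2 n k
  else bell n k (λ t → if t ≤ᵇ r then 1ℚ else 0ℚ)

factRatio : ℕ → ℕ → ℚ
factRatio k l = ((+ (k ℕ.!)) / (l ℕ.!)) {{l !≢0}}

-- v_p(q) ≥ 0 : p does not divide the (reduced) denominator of q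
vpNonneg : ℕ → ℚ → Set
vpNonneg p q = ¬ (p ∣ ℚ.denominatorℕ q)

{-# OPTIONS --safe #-}
-- After multiplying by k!/l!, the summand of B_{l,k} indexed by (j_1,…,j_{l-k+1}) becomes
--   k!/(j_1!⋯) · 1/∏ (t!)^{j_t} · ∏ x_t^{j_t}.
-- Since Σ j_t = k the multinomial coefficient k!/(j_1!⋯) is an integer, and for the
-- restricted weights x_t ∈ {0,1} a nonzero summand only involves t ≤ i < p, so no
-- factor t! of the remaining denominator is divisible by p.  Summing preserves
-- p-integrality.
module Submission where

open import Defs
open import Data.Nat using (ℕ; _≤_; _∸_)
open import Data.Nat.Primality using (Prime)
open import Data.Rational using (_*_)

open import Data.Bool using (true; false; T; _∧_; if_then_else_)
open import Data.Empty using (⊥-elim)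
open import Data.Integer as ℤ using (+_)
import Data.Integer.Properties as ℤ
open import Data.List using (List; []; _∷_; length; map; upTo; concatMap)
open import Data.List.Relation.Unary.All as All using (All; []; _∷_)
import Data.List.Relation.Unary.All.Properties as All
open import Data.Nat as ℕ using (zero; suc; NonZero; _<_; _≡ᵇ_; _≤ᵇ_; _!)
open import Data.Nat.Combinatorics using (k![n∸k]!∣n!)
open import Data.Nat.Divisibility using (_∣_; divides; ∣-trans; *-monoʳ-∣; >⇒∤; _∣0)
open import Data.Nat.GCD using (gcd)
import Data.Nat.Properties as ℕ
open import Data.Nat.Primality using (euclidsLemma; prime⇒nonTrivial; prime⇒nonZero)
open import Data.Product using (_×_; _,_)
open import Data.Rational as ℚ using (ℚ; _/_; _+_; 0ℚ; 1ℚ)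
import Data.Rational.Properties as ℚ
import Data.Rational.Unnormalised as ℚᵘ
import Data.Rational.Unnormalised.Properties as ℚᵘ
open import Data.Sum using (_⊎_; inj₁; inj₂)
open import Data.Unit using (tt)
open import Relation.Binary.PropositionalEquality
open import Relation.Nullary using (¬_)

/-*-/ : ∀ a b c d .{{_ : NonZero b}} .{{_ : NonZero d}} →
        (+ a / b) * (+ c / d) ≡ (+ (a ℕ.* c) / (b ℕ.* d)) {{ℕ.m*n≢0 b d}}
/-*-/ a (suc b) c (suc d) =
  trans (ℚ.toℚᵘ-injective toℚᵘ-eq) (cong (_/ (suc b ℕ.* suc d)) (sym (ℤ.pos-* a c)))
  where
  u v : ℚᵘ.ℚᵘ
  u = ℚᵘ.mkℚᵘ (+ a) b
  v = ℚᵘ.mkℚᵘ (+ c) d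
  toℚᵘ-eq : ℚ.toℚᵘ (ℚ.fromℚᵘ u * ℚ.fromℚᵘ v) ℚᵘ.≃ ℚ.toℚᵘ (ℚ.fromℚᵘ (u ℚᵘ.* v))
  toℚᵘ-eq = ℚᵘ.≃-trans (ℚ.toℚᵘ-homo-* (ℚ.fromℚᵘ u) (ℚ.fromℚᵘ v))
            (ℚᵘ.≃-trans (ℚᵘ.*-cong (ℚ.toℚᵘ-fromℚᵘ u) (ℚ.toℚᵘ-fromℚᵘ v))
                        (ℚᵘ.≃-sym (ℚ.toℚᵘ-fromℚᵘ (u ℚᵘ.* v))))

*≡*⇒/≡/ : ∀ a b c d .{{_ : NonZero b}} .{{_ : NonZero d}} →
          a ℕ.* d ≡ c ℕ.* b → + a / b ≡ + c / d
*≡*⇒/≡/ a (suc b) c (suc d) eq = ℚ.fromℚᵘ-cong {ℚᵘ.mkℚᵘ (+ a) b} {ℚᵘ.mkℚᵘ (+ c) d}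
  (ℚᵘ.*≡* (trans (sym (ℤ.pos-* a (suc d))) (trans (cong +_ eq) (ℤ.pos-* c (suc b)))))

/-*-/-cancel : ∀ a b c .{{_ : NonZero b}} .{{_ : NonZero c}} → (+ a / b) * (+ b / c) ≡ + a / c
/-*-/-cancel a b c = trans (/-*-/ a b b c)
  (*≡*⇒/≡/ (a ℕ.* b) (b ℕ.* c) a c {{ℕ.m*n≢0 b c}} (ℕ.*-assoc a b c))

↧ₙ-/-∣ : ∀ i n .{{_ : NonZero n}} → ℚ.denominatorℕ (i / n) ∣ n
↧ₙ-/-∣ i n = divides (gcd ℤ.∣ i ∣ n) (sym (trans (ℕ.*-comm (gcd ℤ.∣ i ∣ n) (ℚ.denominatorℕ (i / n)))
  (ℤ.+-injective (trans (ℤ.pos-* (ℚ.denominatorℕ (i / n)) (gcd ℤ.∣ i ∣ n)) (ℚ.↧-/ i n)))))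

1ℚ^ℚ : ∀ j → 1ℚ ^ℚ j ≡ 1ℚ
1ℚ^ℚ zero    = refl
1ℚ^ℚ (suc j) = trans (ℚ.*-identityˡ (1ℚ ^ℚ j)) (1ℚ^ℚ j)

*-distribˡ-sumℚ : ∀ c qs → c * sumℚ qs ≡ sumℚ (map (c *_) qs)
*-distribˡ-sumℚ c []       = ℚ.*-zeroʳ c
*-distribˡ-sumℚ c (q ∷ qs) =
  trans (ℚ.*-distribˡ-+ c q (sumℚ qs)) (cong (λ r → c * q + r) (*-distribˡ-sumℚ c qs))

module _ {p} (p-prime : Prime p) where

  prime∤1 : ¬ p ∣ 1
  prime∤1 = >⇒∤ (ℕ.nonTrivial⇒n>1 p {{prime⇒nonTrivial p-prime}})

  prime∤! : ∀ t → t < p → ¬ p ∣ t !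
  prime∤! zero    _   = prime∤1
  prime∤! (suc t) t<p p∣t! with euclidsLemma (suc t) (t !) p-prime p∣t!
  ... | inj₁ p∣1+t = >⇒∤ t<p p∣1+t
  ... | inj₂ p∣t!  = prime∤! t (ℕ.<-trans (ℕ.n<1+n t) t<p) p∣t!

  prime∣^⇒∣ : ∀ a j → p ∣ a ℕ.^ j → p ∣ a
  prime∣^⇒∣ a zero    p∣1 = ⊥-elim (prime∤1 p∣1)
  prime∣^⇒∣ a (suc j) p∣aʲ⁺¹ with euclidsLemma a (a ℕ.^ j) p-prime p∣aʲ⁺¹
  ... | inj₁ p∣a  = p∣a
  ... | inj₂ p∣aʲ = prime∣^⇒∣ a j p∣aʲ

  vpNonneg-0 : vpNonneg p 0ℚ
  vpNonneg-0 = prime∤1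

  -- q + r is the normalisation of a fraction with denominator ↧q · ↧r.
  vpNonneg-+ : ∀ {q r} → vpNonneg p q → vpNonneg p r → vpNonneg p (q + r)
  vpNonneg-+ {q@record{}} {r@record{}} p∤↧q p∤↧r p∣↧q+r
    with euclidsLemma (ℚ.denominatorℕ q) (ℚ.denominatorℕ r) p-prime
           (∣-trans p∣↧q+r (↧ₙ-/-∣ (ℚ.numerator q ℤ.* ℚ.denominator r ℤ.+ ℚ.numerator r ℤ.* ℚ.denominator q)
                                    (ℚ.denominatorℕ q ℕ.* ℚ.denominatorℕ r)))
  ... | inj₁ p∣↧q = p∤↧q p∣↧q
  ... | inj₂ p∣↧r = p∤↧r p∣↧r

  vpNonneg-sumℚ : ∀ {qs} → All (vpNonneg p) qs → vpNonneg p (sumℚ qs)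
  vpNonneg-sumℚ []                    = vpNonneg-0
  vpNonneg-sumℚ {q ∷ qs} (p∤q ∷ p∤qs) = vpNonneg-+ {q} {sumℚ qs} p∤q (vpNonneg-sumℚ p∤qs)

  vpNonneg-/ : ∀ i n .{{_ : NonZero n}} → ¬ p ∣ n → vpNonneg p (i / n)
  vpNonneg-/ i n p∤n p∣↧ = p∤n (∣-trans p∣↧ (↧ₙ-/-∣ i n))

factorials : List ℕ → ℕ
factorials []       = 1
factorials (j ∷ js) = j ! ℕ.* factorials js

factorialPowers : ℕ → List ℕ → ℕ
factorialPowers t []       = 1
factorialPowers t (j ∷ js) = (t !) ℕ.^ j ℕ.* factorialPowers (suc t) js

denom≡factorials*factorialPowers : ∀ t js → denom t js ≡ factorials js ℕ.* factorialPowers t js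
denom≡factorials*factorialPowers t []       = refl
denom≡factorials*factorialPowers t (j ∷ js) =
  trans (cong (j ! ℕ.* (t !) ℕ.^ j ℕ.*_) (denom≡factorials*factorialPowers (suc t) js))
        (ℕ.[m*n]*[o*p]≡[m*o]*[n*p] (j !) ((t !) ℕ.^ j) (factorials js) (factorialPowers (suc t) js))

factorials∣sumJ! : ∀ js → factorials js ∣ sumJ js !
factorials∣sumJ! []       = divides 1 refl
factorials∣sumJ! (j ∷ js) = ∣-trans (*-monoʳ-∣ (j !) (factorials∣sumJ! js))
  (subst (λ n → j ! ℕ.* n ! ∣ (j ℕ.+ sumJ js) !) (ℕ.m+n∸m≡n j (sumJ js))
         (k![n∸k]!∣n! (ℕ.m≤m+n j (sumJ js))))

tuples-length : ∀ m b → All (λ js → length js ≡ m) (tuples m b)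
tuples-length zero    b = refl ∷ []
tuples-length (suc m) b = prepend-length (upTo (suc b))
  where
  prepend-length : ∀ ns → All (λ js → length js ≡ suc m) (concatMap (λ n → map (n ∷_) (tuples m b)) ns)
  prepend-length []       = []
  prepend-length (n ∷ ns) = All.++⁺ (All.map⁺ (All.map (cong suc) (tuples-length m b))) (prepend-length ns)

ZeroOne≤ : ℕ → (ℕ → ℚ) → ℕ → Set
ZeroOne≤ i x t = x t ≡ 0ℚ ⊎ (t ≤ i × x t ≡ 1ℚ)

ZeroOne≤On : ℕ → (ℕ → ℚ) → ℕ → ℕ → Set
ZeroOne≤On i x t n = ∀ s → t ≤ s → s < t ℕ.+ n → ZeroOne≤ i x s

ZeroOne≤On-head : ∀ {i x t n} → ZeroOne≤On i x t (suc n) → ZeroOne≤ i x t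
ZeroOne≤On-head {t = t} zo = zo t ℕ.≤-refl (ℕ.m<m+n t ℕ.z<s)

ZeroOne≤On-tail : ∀ {i x t n} → ZeroOne≤On i x t (suc n) → ZeroOne≤On i x (suc t) n
ZeroOne≤On-tail {t = t} {n} zo s t<s s<1+t+n = zo s (ℕ.<⇒≤ t<s) (subst (s <_) (sym (ℕ.+-suc t n)) s<1+t+n)

indicator-zeroOne≤ : ∀ i t → ZeroOne≤ i (λ s → if s ≤ᵇ i then 1ℚ else 0ℚ) t
indicator-zeroOne≤ i t with t ≤ᵇ i in t≤ᵇi
... | true  = inj₂ (ℕ.≤ᵇ⇒≤ t i (subst T (sym t≤ᵇi) tt) , refl)
... | false = inj₁ refl

const1-zeroOne≤On : ∀ {i n} → n ≤ i → ZeroOne≤On i (λ _ → 1ℚ) 1 n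
const1-zeroOne≤On n≤i s _ s<1+n = inj₂ (ℕ.≤-trans (ℕ.≤-pred s<1+n) n≤i , refl)

factRatio*bellTerm : ∀ k l x js → factRatio k l * bellTerm l x js ≡ (+ (k !) / denom 1 js) {{denom≢0 1 js}} * xprod x 1 js
factRatio*bellTerm k l x js = trans (sym (ℚ.*-assoc (factRatio k l) _ (xprod x 1 js)))
  (cong (_* xprod x 1 js) (/-*-/-cancel (k !) (l !) (denom 1 js) {{l ℕ.!≢0}} {{denom≢0 1 js}}))

module _ {p} (p-prime : Prime p) {i} (i<p : i < p) where

  xprod-zeroOne : ∀ {x} t js → ZeroOne≤On i x t (length js) →
                  xprod x t js ≡ 0ℚ ⊎ (xprod x t js ≡ 1ℚ × ¬ p ∣ factorialPowers t js)
  xprod-zeroOne t [] _ = inj₂ (refl , prime∤1 p-prime)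
  xprod-zeroOne {x} t (j ∷ js) zo
    with xprod-zeroOne (suc t) js (ZeroOne≤On-tail zo) | j | ZeroOne≤On-head zo
  ... | inj₁ rest≡0 | j | _ = inj₁ (trans (cong (x t ^ℚ j *_) rest≡0) (ℚ.*-zeroʳ (x t ^ℚ j)))
  ... | inj₂ (rest≡1 , p∤rest) | zero | inj₁ _ =
    inj₂ (trans (ℚ.*-identityˡ _) rest≡1 , λ p∣ → p∤rest (subst (p ∣_) (ℕ.+-identityʳ _) p∣))
  ... | inj₂ _ | suc j | inj₁ xt≡0 = inj₁ (begin
    x t * x t ^ℚ j * xprod x (suc t) js ≡⟨ cong (λ y → y * x t ^ℚ j * xprod x (suc t) js) xt≡0 ⟩
    0ℚ * x t ^ℚ j * xprod x (suc t) js  ≡⟨ cong (_* xprod x (suc t) js) (ℚ.*-zeroˡ (x t ^ℚ j)) ⟩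
    0ℚ * xprod x (suc t) js             ≡⟨ ℚ.*-zeroˡ (xprod x (suc t) js) ⟩
    0ℚ                                  ∎)
    where open ≡-Reasoning
  ... | inj₂ (rest≡1 , p∤rest) | j | inj₂ (t≤i , xt≡1) =
    inj₂ (trans (cong₂ _*_ (trans (cong (_^ℚ j) xt≡1) (1ℚ^ℚ j)) rest≡1) (ℚ.*-identityˡ 1ℚ) , p∤powers)
    where
    p∤powers : ¬ p ∣ (t !) ℕ.^ j ℕ.* factorialPowers (suc t) js
    p∤powers p∣ with euclidsLemma ((t !) ℕ.^ j) (factorialPowers (suc t) js) p-prime p∣
    ... | inj₁ p∣t!ʲ  = prime∤! p-prime t (ℕ.≤-<-trans t≤i i<p) (prime∣^⇒∣ p-prime (t !) j p∣t!ʲ)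
    ... | inj₂ p∣rest = p∤rest p∣rest

  vpNonneg-multinomial*xprod : ∀ {x} js → ZeroOne≤On i x 1 (length js) →
    vpNonneg p ((+ (sumJ js !) / denom 1 js) {{denom≢0 1 js}} * xprod x 1 js)
  vpNonneg-multinomial*xprod {x} js zo with factorials∣sumJ! js | xprod-zeroOne 1 js zo
  ... | _ | inj₁ X≡0 =
    subst (vpNonneg p) (sym (trans (cong (A *_) X≡0) (ℚ.*-zeroʳ A))) (vpNonneg-0 p-prime)
    where
    A : ℚ
    A = (+ (sumJ js !) / denom 1 js) {{denom≢0 1 js}}
  ... | divides m k!≡m*F | inj₂ (X≡1 , p∤C) =
    subst (vpNonneg p) (sym (trans (cong₂ _*_ multinomial≡ X≡1) (ℚ.*-identityʳ (+ m / C)))) (vpNonneg-/ p-prime (+ m) C p∤C)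
    where
    F C D : ℕ
    F = factorials js
    C = factorialPowers 1 js
    D = denom 1 js
    instance
      C≢0 : NonZero C
      C≢0 = ℕ.≢-nonZero (λ C≡0 → p∤C (subst (p ∣_) (sym C≡0) (p ∣0)))
      D≢0 : NonZero D
      D≢0 = denom≢0 1 js
    multinomial≡ : + (sumJ js !) / D ≡ + m / C
    multinomial≡ = *≡*⇒/≡/ (sumJ js !) D m C (begin
      sumJ js ! ℕ.* C  ≡⟨ cong (ℕ._* C) k!≡m*F ⟩
      m ℕ.* F ℕ.* C    ≡⟨ ℕ.*-assoc m F C ⟩
      m ℕ.* (F ℕ.* C)  ≡⟨ cong (m ℕ.*_) (sym (denom≡factorials*factorialPowers 1 js)) ⟩
      m ℕ.* D          ∎)
      where open ≡-Reasoning

  vpNonneg-factRatio*bell : ∀ {x} k l → ZeroOne≤On i x 1 (suc (l ∸ k)) → vpNonneg p (factRatio k l * bell l k x)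
  vpNonneg-factRatio*bell {x} k l zo =
    subst (vpNonneg p) (sym (*-distribˡ-sumℚ (factRatio k l) (map summand allTuples)))
      (vpNonneg-sumℚ p-prime (All.map⁺ {f = factRatio k l *_} (All.map⁺ {f = summand}
        (All.map (λ {js} → vpNonneg-summand {js}) (tuples-length (suc (l ∸ k)) k)))))
    where
    allTuples : List (List ℕ)
    allTuples = tuples (suc (l ∸ k)) k
    summand : List ℕ → ℚ
    summand js = if (sumJ js ≡ᵇ k) ∧ (sumTJ 1 js ≡ᵇ l) then bellTerm l x js else 0ℚ
    vpNonneg-summand : ∀ {js} → length js ≡ suc (l ∸ k) → vpNonneg p (factRatio k l * summand js)
    vpNonneg-summand {js} length≡ with sumJ js ≡ᵇ k in sumJ≡ᵇk | sumTJ 1 js ≡ᵇ l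
    ... | false | _     = subst (vpNonneg p) (sym (ℚ.*-zeroʳ (factRatio k l))) (vpNonneg-0 p-prime)
    ... | true  | false = subst (vpNonneg p) (sym (ℚ.*-zeroʳ (factRatio k l))) (vpNonneg-0 p-prime)
    ... | true  | true  with ℕ.≡ᵇ⇒≡ (sumJ js) k (subst T (sym sumJ≡ᵇk) tt)
    ...   | refl = subst (vpNonneg p) (sym (factRatio*bellTerm k l x js))
                    (vpNonneg-multinomial*xprod js (subst (ZeroOne≤On i x 1) (sym length≡) zo))

  vpNonneg-factRatio*stirling2≤ : ∀ k l → vpNonneg p (factRatio k l * stirling2≤ i l k)
  vpNonneg-factRatio*stirling2≤ k l with suc (l ∸ k) ≤ᵇ i in l-k+1≤ᵇi
  ... | true  = vpNonneg-factRatio*bell k l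
                  (const1-zeroOne≤On (ℕ.≤ᵇ⇒≤ (suc (l ∸ k)) i (subst T (sym l-k+1≤ᵇi) tt)))
  ... | false = vpNonneg-factRatio*bell k l (λ s _ _ → indicator-zeroOne≤ i s)

≤∸1⇒< : ∀ {i p} .{{_ : NonZero p}} → i ≤ p ∸ 1 → i < p
≤∸1⇒< {p = suc p} i≤p = ℕ.s≤s i≤p

lemma3p13 : (p : ℕ) → Prime p → (i : ℕ) → 1 ≤ i → i ≤ p ∸ 1 → (k : ℕ) → 1 ≤ k →
    (l : ℕ) → k ≤ l → vpNonneg p (factRatio k l * stirling2≤ i l k)
lemma3p13 p p-prime i _ i≤p∸1 k _ l _ =
  vpNonneg-factRatio*stirling2≤ p-prime (≤∸1⇒< {{prime⇒nonZero p-prime}} i≤p∸1) k l
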